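{- Let $T$ be a finite tree and let $m$ be a positive integer. If $m\ge \operatorname{diam}(T)-2$, where $\operatorname{diam}(T)$ is the diameter of $T$, then $\chi'_g(T;m,1)\le \Delta(T)+1$, where $\Delta(T)$ is the maximum degree of $T$.
   Context: The $(m,1)$-edge coloring game on a finite simple graph $G$ with a set of colors $X$ is played alternately by two players, Maker and Breaker, with Maker playing first. On each turn Maker makes $m$ moves and Breaker makes one move; a move consists of coloring one uncolored edge of $G$ with a color from $X$ so that adjacent edges (edges sharing an endpoint) always receive distinct colors. Maker wins if eventually every edge is colored; Breaker wins if at some point the player who is to move cannot color any edge. The $(m,1)$-game chromatic index $\chi'_g(G;m,1)$ is the smallest nonnegative integer $k$ such that Maker has a winning strategy when $|X|=k$. -}

module Defs where

open import Data.Nat using (ℕ; zero; suc; _+_; _<_; _≤_; _⊔_; _%_)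
open import Data.Fin using (Fin; zero; suc; inject₁; fromℕ; _≟_)
open import Data.Bool using (Bool; true; false; if_then_else_; _∨_)
open import Data.Maybe using (Maybe; just; nothing; is-just)
open import Data.Product using (Σ; ∃; ∃-syntax; _×_; _,_; proj₁; proj₂)
open import Data.Sum using (_⊎_)
open import Relation.Nullary using (¬_; does)
open import Relation.Binary.PropositionalEquality using (_≡_; _≢_)
open import Function.Definitions using (Injective)

countFin : ∀ {e} → (Fin e → Bool) → ℕ
countFin {zero}  p = 0
countFin {suc e} p = (if p zero then 1 else 0) + countFin (λ i → p (suc i))

maxFin : ∀ {n} → (Fin n → ℕ) → ℕ
maxFin {zero}  f = 0
maxFin {suc n} f = f zero ⊔ maxFin (λ i → f (suc i))

SameEnds : ∀ {n} → Fin n × Fin n → Fin n × Fin n → Set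
SameEnds (a , b) (c , d) = (a ≡ c × b ≡ d) ⊎ (a ≡ d × b ≡ c)

record Graph (n e : ℕ) : Set where
  field
    ends      : Fin e → Fin n × Fin n
    loopless  : ∀ i → proj₁ (ends i) ≢ proj₂ (ends i)
    noMulti   : ∀ i j → SameEnds (ends i) (ends j) → i ≡ j
open Graph public

module _ {n e : ℕ} (G : Graph n e) where

  Adj : Fin n → Fin n → Set
  Adj u v = ∃[ i ] SameEnds (ends G i) (u , v)

  incident : Fin n → Fin e → Bool
  incident v i = does (proj₁ (ends G i) ≟ v) ∨ does (proj₂ (ends G i) ≟ v)

  degree : Fin n → ℕ
  degree v = countFin (incident v)

  maxDegree : ℕ
  maxDegree = maxFin degree

  data Walk : Fin n → Fin n → ℕ → Set where
    here : ∀ {u} → Walk u u 0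
    step : ∀ {u w v ℓ} → Adj u w → Walk w v ℓ → Walk u v (suc ℓ)

  Connected : Set
  Connected = ∀ u v → ∃[ ℓ ] Walk u v ℓ

  HasCycle : Set
  HasCycle = ∃[ j ] Σ (Fin (suc (suc (suc j))) → Fin n) λ f →
    Injective _≡_ _≡_ f ×
    (∀ (i : Fin (suc (suc j))) → Adj (f (inject₁ i)) (f (suc i))) ×
    Adj (f (fromℕ (suc (suc j)))) (f zero)

  IsTree : Set
  IsTree = Connected × ¬ HasCycle

  Dist : Fin n → Fin n → ℕ → Set
  Dist u v d = Walk u v d × (∀ ℓ → Walk u v ℓ → d ≤ ℓ)

  IsDiameter : ℕ → Set
  IsDiameter d = (∀ u v → ∃[ δ ] (Dist u v δ × δ ≤ d)) × (∃[ u ] ∃[ v ] Dist u v d)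

  EdgeAdj : Fin e → Fin e → Set
  EdgeAdj i j with ends G i | ends G j
  ... | (a , b) | (c , d) = a ≡ c ⊎ a ≡ d ⊎ b ≡ c ⊎ b ≡ d

  Colouring : ℕ → Set
  Colouring k = Fin e → Maybe (Fin k)

  update : ∀ {k} → Colouring k → Fin e → Fin k → Colouring k
  update c i x j = if does (j ≟ i) then just x else c j

  Legal : ∀ {k} → Colouring k → Fin e → Fin k → Set
  Legal c i x = c i ≡ nothing × (∀ j → j ≢ i → EdgeAdj i j → c j ≢ just x)

  numColoured : ∀ {k} → Colouring k → ℕ
  numColoured c = countFin (λ i → is-just (c i))

  Complete : ∀ {k} → Colouring k → Set
  Complete c = ∀ i → c i ≢ nothing

  -- Maker moves first, m moves per turn, then Breaker one move; so the
  -- t-th move (t = number of coloured edges, 0-based) is Maker's iff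
  -- t mod (m+1) < m.
  MakersTurn : ℕ → ∀ {k} → Colouring k → Set
  MakersTurn m c = numColoured c % suc m < m

  data MakerWins (m k : ℕ) : Colouring k → Set where
    done    : ∀ {c} → Complete c → MakerWins m k c
    maker   : ∀ {c} → MakersTurn m c → (i : Fin e) (x : Fin k) →
              Legal c i x → MakerWins m k (update c i x) → MakerWins m k c
    breaker : ∀ {c} → ¬ MakersTurn m c →
              (∃[ i ] ∃[ x ] Legal c i x) →
              (∀ i x → Legal c i x → MakerWins m k (update c i x)) →
              MakerWins m k c

  empty : ∀ {k} → Colouring k
  empty _ = nothing

  MakerWinsWith : ℕ → ℕ → Set
  MakerWinsWith m k = MakerWins m k empty

  -- χ'_g(G;m,1) ≤ b  (χ'_g is the least k for which Maker wins; this is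
  -- at most b iff Maker wins for some k ≤ b)
  GameChromaticIndex≤ : ℕ → ℕ → Set
  GameChromaticIndex≤ m b = ∃[ k ] (k ≤ b × MakerWinsWith m k)

-- Since the diameter is at most m + 2, some vertex ρ lies within distance m + 1 of every
-- vertex (the second vertex of a diametral path does when the diameter is m + 2: a vertex
-- at maximal distance from another is a leaf).  Rooted at ρ, the upper end of every edge
-- has depth at most m.  Maker keeps the set of coloured edges closed upwards: the parent
-- edge of the upper end of every coloured edge is coloured.  After Breaker colours an
-- edge h, Maker's next moves colour the at most m uncoloured edges on the path from h to
-- the root, and any remaining moves go to uncoloured edges whose parent edge is coloured.
-- An uncoloured edge g then meets at its lower end no coloured edge except possibly h,
-- and at its upper end at most Δ - 1 other edges, so one of the Δ + 1 colours is free
-- for g; in particular neither player is ever stuck.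
module Submission where

open import Defs
open import Data.Nat
  using (ℕ; zero; suc; pred; _+_; _∸_; _≤_; _<_; _≥_; z≤n; s≤s; s≤s⁻¹; _≤?_; _<?_; >-nonZero)
open import Data.Nat.Properties
  using (≤-refl; ≤-trans; ≤-antisym; ≤-reflexive; <⇒≤; <-≤-trans; <-asym; ≰⇒>; ≮⇒≥; <⇒≱; <-cmp; ≤-<-connex;
         n≤1+n; m≤n⇒m≤1+n; 1+n≰n; n≤0⇒n≡0; m≤m⊔n; m≤n⊔m; m≤m+n; m≤n+m; m≤n+m∸n;
         +-identityʳ; +-suc; +-comm; +-assoc; +-monoˡ-≤; +-monoʳ-≤; +-cancelˡ-≡; +-cancelʳ-≤;
         n∸n≡0; m∸n+n≡m; m+n∸m≡n; +-∸-assoc; ∸-monoʳ-≤; ∸-monoʳ-<; ∸-cancelˡ-≡; m<n⇒0<n∸m;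
         suc-pred; pred-mono-≤; pred[m∸n]≡m∸[1+n]; m≤pred[n]⇒suc[m]≤n; module ≤-Reasoning)
open import Data.Nat.DivMod using (_%_; %-distribˡ-+; m%n%n≡m%n; m<n⇒m%n≡m; m%n<n; n%n≡0)
open import Data.Fin using (Fin; zero; suc; toℕ; inject₁; fromℕ; punchIn; punchOut; _≟_)
open import Data.Fin.Properties
  using (any?; suc-injective; toℕ-injective; toℕ<n; toℕ-inject₁; toℕ-fromℕ;
         punchInᵢ≢i; punchOut-cong; punchOut-punchIn)
open import Data.Bool using (Bool; true; false; _∨_; _∧_; not)
open import Data.Bool.Properties using (∨-zeroʳ; ∧-zeroʳ; ∧-identityʳ)
open import Data.Maybe using (Maybe; just; nothing; is-just)
open import Data.Maybe.Properties using (just-injective) renaming (≡-dec to ≡-dec-Maybe)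
open import Data.Product using (Σ; ∃-syntax; _×_; _,_; proj₁; proj₂)
open import Data.Sum using (_⊎_; inj₁; inj₂)
open import Data.Empty using (⊥-elim)
open import Function using (_∘_)
open import Relation.Nullary using (¬_; yes; no; Dec; does; contradiction)
open import Relation.Nullary.Decidable using (dec-true; dec-false)
open import Relation.Binary using (tri<; tri≈; tri>)
open import Relation.Binary.PropositionalEquality
  using (_≡_; _≢_; refl; sym; trans; cong; cong₂; subst; subst₂; module ≡-Reasoning)

countFin-cong : ∀ {e} {p q : Fin e → Bool} → (∀ i → p i ≡ q i) → countFin p ≡ countFin q
countFin-cong {zero}  p≡q = refl
countFin-cong {suc e} p≡q rewrite p≡q zero = cong (_ +_) (countFin-cong (p≡q ∘ suc))

countFin-≤ : ∀ {e} (p : Fin e → Bool) → countFin p ≤ e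
countFin-≤ {zero}  p = z≤n
countFin-≤ {suc e} p with p zero
... | true  = s≤s (countFin-≤ (p ∘ suc))
... | false = m≤n⇒m≤1+n (countFin-≤ (p ∘ suc))

countFin-false : ∀ {e} → countFin {e} (λ _ → false) ≡ 0
countFin-false {zero}  = refl
countFin-false {suc e} = countFin-false {e}

countFin-≟ : ∀ {e} (h : Fin e) → countFin (λ j → does (j ≟ h)) ≡ 1
countFin-≟ {suc e} zero    = cong suc (countFin-false {e})
countFin-≟ {suc e} (suc h) = countFin-≟ h

countFin-∨ : ∀ {e} (p q : Fin e → Bool) → countFin (λ i → p i ∨ q i) ≤ countFin p + countFin q
countFin-∨ {zero}  p q = z≤n
countFin-∨ {suc e} p q with p zero | q zero | countFin-∨ (p ∘ suc) (q ∘ suc)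
... | true  | true  | rest = s≤s (≤-trans rest (+-monoʳ-≤ (countFin (p ∘ suc)) (n≤1+n _)))
... | true  | false | rest = s≤s rest
... | false | true  | rest = ≤-trans (s≤s rest) (≤-reflexive (sym (+-suc _ _)))
... | false | false | rest = rest

countFin-insert : ∀ {e} {p q : Fin e → Bool} (g : Fin e) → (∀ j → j ≢ g → q j ≡ p j) →
  p g ≡ false → q g ≡ true → countFin q ≡ suc (countFin p)
countFin-insert {suc e} zero agree pg qg rewrite pg | qg =
  cong suc (countFin-cong (λ i → agree (suc i) λ ()))
countFin-insert {suc e} (suc g) agree pg qg rewrite agree zero (λ ()) =
  trans (cong (_ +_) (countFin-insert g (λ j j≢g → agree (suc j) (j≢g ∘ suc-injective)) pg qg))
        (+-suc _ _)

countFin-< : ∀ {e} (p : Fin e → Bool) (g : Fin e) → p g ≡ false → countFin p < e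
countFin-< {e} p g pg =
  subst (_≤ e) (countFin-insert g agree pg (cong (_∨ p g) (dec-true (g ≟ g) refl))) (countFin-≤ _)
  where
    agree : ∀ j → j ≢ g → does (j ≟ g) ∨ p j ≡ p j
    agree j j≢g rewrite dec-false (j ≟ g) j≢g = refl

maxFin-upper : ∀ {n} (f : Fin n → ℕ) i → f i ≤ maxFin f
maxFin-upper f zero    = m≤m⊔n _ _
maxFin-upper f (suc i) = ≤-trans (maxFin-upper (f ∘ suc) i) (m≤n⊔m _ _)

removeColour : ∀ {k} → Fin (suc k) → Maybe (Fin (suc k)) → Maybe (Fin k)
removeColour y nothing  = nothing
removeColour y (just z) with y ≟ z
... | yes _  = nothing
... | no y≢z = just (punchOut y≢z)

removeColour-punchIn : ∀ {k} (y : Fin (suc k)) (x : Fin k) → removeColour y (just (punchIn y x)) ≡ just x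
removeColour-punchIn y x with y ≟ punchIn y x
... | yes y≡ = ⊥-elim (punchInᵢ≢i y x (sym y≡))
... | no  _  = cong just (trans (punchOut-cong y refl) (punchOut-punchIn y))

unusedColour : ∀ {e k} (s : Fin e → Bool) (c : Fin e → Maybe (Fin k)) → countFin s < k →
  ∃[ x ] (∀ j → s j ≡ true → c j ≢ just x)
unusedColour {zero} {suc k} s c _ = zero , λ ()
unusedColour {suc e} s c few with s zero in s₀
... | false with unusedColour (s ∘ suc) (c ∘ suc) few
...   | x , unused = x , λ { zero s₀′ → contradiction (trans (sym s₀′) s₀) λ () ; (suc j) → unused j }
unusedColour {suc e} {suc k} s c (s≤s few) | true with c zero in c₀
... | nothing with unusedColour (s ∘ suc) (c ∘ suc) (m≤n⇒m≤1+n few)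
...   | x , unused = x , λ { zero _ c₀≡ → contradiction (trans (sym c₀) c₀≡) λ () ; (suc j) → unused j }
unusedColour {suc e} {suc k} s c (s≤s few) | true | just y
  with unusedColour (s ∘ suc) (removeColour y ∘ c ∘ suc) few
... | x , unused = punchIn y x , λ
  { zero _ c₀≡ → punchInᵢ≢i y x (sym (just-injective (trans (sym c₀) c₀≡)))
  ; (suc j) sj cj≡ → unused j sj (trans (cong (removeColour y) cj≡) (removeColour-punchIn y x)) }

least-witness : (P : ℕ → Set) → (∀ a → Dec (P a)) → ∀ N → P N →
  ∃[ a ] (a ≤ N × P a × (∀ i → i < a → ¬ P i))
least-witness P P? N pN with P? 0
... | yes p₀ = 0 , z≤n , p₀ , λ _ ()
least-witness P P? zero    p₀ | no ¬p₀ = ⊥-elim (¬p₀ p₀)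
least-witness P P? (suc N) pN | no ¬p₀ with least-witness (P ∘ suc) (P? ∘ suc) N pN
... | a , a≤N , pa , below = suc a , s≤s a≤N , pa , λ
  { zero _ → ¬p₀ ; (suc i) i<a → below i (s≤s⁻¹ i<a) }

suc-% : ∀ t m → suc t % suc m ≡ suc (t % suc m) % suc m
suc-% t m = begin
  (1 + t) % d                  ≡⟨ %-distribˡ-+ 1 t d ⟩
  (1 % d + t % d) % d          ≡⟨ cong (λ r → (1 % d + r) % d) (sym (m%n%n≡m%n t d)) ⟩
  (1 % d + t % d % d) % d      ≡⟨ sym (%-distribˡ-+ 1 (t % d) d) ⟩
  (1 + t % d) % d              ∎
  where open ≡-Reasoning
        d = suc m

%-suc-< : ∀ t m → t % suc m < m → suc t % suc m ≡ suc (t % suc m)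
%-suc-< t m lt = trans (suc-% t m) (m<n⇒m%n≡m (s≤s lt))

%-≮ : ∀ t m → ¬ (t % suc m < m) → t % suc m ≡ m
%-≮ t m ≮ = ≤-antisym (s≤s⁻¹ (m%n<n t (suc m))) (≮⇒≥ ≮)

%-suc-≮ : ∀ t m → ¬ (t % suc m < m) → suc t % suc m ≡ 0
%-suc-≮ t m ≮ = trans (suc-% t m) (trans (cong (λ r → suc r % suc m) (%-≮ t m ≮)) (n%n≡0 (suc m)))

module _ {n : ℕ} where

  SameEnds-sym : {p q : Fin n × Fin n} → SameEnds p q → SameEnds q p
  SameEnds-sym (inj₁ (a , b)) = inj₁ (sym a , sym b)
  SameEnds-sym (inj₂ (a , b)) = inj₂ (sym b , sym a)

  SameEnds-trans : {p q r : Fin n × Fin n} → SameEnds p q → SameEnds q r → SameEnds p r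
  SameEnds-trans (inj₁ (a , b)) (inj₁ (c , d)) = inj₁ (trans a c , trans b d)
  SameEnds-trans (inj₁ (a , b)) (inj₂ (c , d)) = inj₂ (trans a c , trans b d)
  SameEnds-trans (inj₂ (a , b)) (inj₁ (c , d)) = inj₂ (trans a d , trans b c)
  SameEnds-trans (inj₂ (a , b)) (inj₂ (c , d)) = inj₁ (trans a d , trans b c)

module _ {n e : ℕ} (G : Graph n e) where

  Adj-sym : ∀ {u v} → Adj G u v → Adj G v u
  Adj-sym (i , s) = i , SameEnds-trans s (inj₂ (refl , refl))

  Adj-irrefl : ∀ {u v} → Adj G u v → u ≢ v
  Adj-irrefl (i , inj₁ (a , b)) u≡v = loopless G i (trans a (trans u≡v (sym b)))
  Adj-irrefl (i , inj₂ (a , b)) u≡v = loopless G i (trans a (trans (sym u≡v) (sym b)))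

  Adj-ends : ∀ i → Adj G (proj₁ (ends G i)) (proj₂ (ends G i))
  Adj-ends i = i , inj₁ (refl , refl)

  Endpoint : Fin n → Fin e → Set
  Endpoint v i = v ≡ proj₁ (ends G i) ⊎ v ≡ proj₂ (ends G i)

  EdgeAdj⇒commonEnd : ∀ {i j} → EdgeAdj G i j → ∃[ z ] (Endpoint z i × Endpoint z j)
  EdgeAdj⇒commonEnd (inj₁ a≡c)               = _ , inj₁ refl , inj₁ a≡c
  EdgeAdj⇒commonEnd (inj₂ (inj₁ a≡d))        = _ , inj₁ refl , inj₂ a≡d
  EdgeAdj⇒commonEnd (inj₂ (inj₂ (inj₁ b≡c))) = _ , inj₂ refl , inj₁ b≡c
  EdgeAdj⇒commonEnd (inj₂ (inj₂ (inj₂ b≡d))) = _ , inj₂ refl , inj₂ b≡d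

  incident-endpoint : ∀ {v i} → Endpoint v i → incident G v i ≡ true
  incident-endpoint {v} {i} (inj₁ v≡a)
    rewrite dec-true (proj₁ (ends G i) ≟ v) (sym v≡a) = refl
  incident-endpoint {v} {i} (inj₂ v≡b)
    rewrite dec-true (proj₂ (ends G i) ≟ v) (sym v≡b) = ∨-zeroʳ _

  degree-∸1 : ∀ {v g} → Endpoint v g →
    suc (countFin (λ j → incident G v j ∧ not (does (j ≟ g)))) ≡ degree G v
  degree-∸1 {v} {g} v∈g = sym (countFin-insert g others g-excluded (incident-endpoint v∈g))
    where
      others : ∀ j → j ≢ g → incident G v j ≡ incident G v j ∧ not (does (j ≟ g))
      others j j≢g rewrite dec-false (j ≟ g) j≢g = sym (∧-identityʳ _)
      g-excluded : incident G v g ∧ not (does (g ≟ g)) ≡ false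
      g-excluded rewrite dec-true (g ≟ g) refl = ∧-zeroʳ _

  degree≤maxDegree : ∀ v → degree G v ≤ maxDegree G
  degree≤maxDegree = maxFin-upper (degree G)

  Walk-snoc : ∀ {u w v ℓ} → Walk G u w ℓ → Adj G w v → Walk G u v (suc ℓ)
  Walk-snoc here         a = step a here
  Walk-snoc (step a′ w) a = step a′ (Walk-snoc w a)

  Walk-reverse : ∀ {u v ℓ} → Walk G u v ℓ → Walk G v u ℓ
  Walk-reverse here       = here
  Walk-reverse (step a w) = Walk-snoc (Walk-reverse w) (Adj-sym a)

  Dist-sym : ∀ {u v δ} → Dist G u v δ → Dist G v u δ
  Dist-sym (w , shortest) = Walk-reverse w , λ ℓ w′ → shortest ℓ (Walk-reverse w′)

  Eccentricity≤ : Fin n → ℕ → Set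
  Eccentricity≤ ρ r = ∀ v → ∃[ δ ] (Dist G v ρ δ × δ ≤ r)

  Dist-unique : ∀ {u v δ δ′} → Dist G u v δ → Dist G u v δ′ → δ ≡ δ′
  Dist-unique (w , shortest) (w′ , shortest′) = ≤-antisym (shortest _ w′) (shortest′ _ w)

  SimplePath : (ℕ → Fin n) → ℕ → Set
  SimplePath f ℓ = (∀ k → k < ℓ → Adj G (f k) (f (suc k))) ×
                   (∀ i j → i ≤ ℓ → j ≤ ℓ → f i ≡ f j → i ≡ j)

  closedPath⇒cycle : ∀ f ℓ → 2 ≤ ℓ → SimplePath f ℓ → Adj G (f ℓ) (f 0) → HasCycle G
  closedPath⇒cycle f (suc zero) (s≤s ()) _ _
  closedPath⇒cycle f (suc (suc j)) _ (steps , injective) closing =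
    j , f ∘ toℕ ,
    (λ {x} {y} fx≡fy → toℕ-injective (injective _ _ (s≤s⁻¹ (toℕ<n x)) (s≤s⁻¹ (toℕ<n y)) fx≡fy)) ,
    (λ i → subst (λ k → Adj G (f k) (f (suc (toℕ i)))) (sym (toℕ-inject₁ i))
                 (steps (toℕ i) (toℕ<n i))) ,
    subst (λ k → Adj G (f k) (f 0)) (sym (toℕ-fromℕ _)) closing

  -- Walk along f from f 0 to f a = g b, then back along g to g 0.
  joinPaths⇒cycle : ∀ f a g b → 2 ≤ a + b → SimplePath f a → SimplePath g b → f a ≡ g b →
    (∀ i j → i ≤ a → j < b → f i ≢ g j) → Adj G (g 0) (f 0) → HasCycle G
  joinPaths⇒cycle f a g b 2≤a+b (f-steps , f-inj) (g-steps , g-inj) meet disjoint closing =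
    closedPath⇒cycle h N 2≤a+b (steps , injective) closing′
    where
      N = a + b

      h : ℕ → Fin n
      h k with k ≤? a
      ... | yes _ = f k
      ... | no  _ = g (N ∸ k)

      h-f : ∀ {k} → k ≤ a → h k ≡ f k
      h-f {k} k≤a with k ≤? a
      ... | yes _   = refl
      ... | no  k≰a = ⊥-elim (k≰a k≤a)

      h-g : ∀ {k} → a ≤ k → h k ≡ g (N ∸ k)
      h-g {k} a≤k with k ≤? a
      ... | no  _   = refl
      ... | yes k≤a rewrite ≤-antisym k≤a a≤k | m+n∸m≡n a b = meet

      N∸a≡b : N ∸ a ≡ b
      N∸a≡b = m+n∸m≡n a b

      closing′ : Adj G (h N) (h 0)
      closing′ =
        subst₂ (Adj G) (sym (trans (h-g (m≤m+n a b)) (cong g (n∸n≡0 N)))) (sym (h-f z≤n)) closing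

      back-≤ : ∀ {k} → a ≤ k → N ∸ k ≤ b
      back-≤ {k} a≤k = subst (N ∸ k ≤_) N∸a≡b (∸-monoʳ-≤ N a≤k)

      back-< : ∀ {k} → a < k → k ≤ N → N ∸ k < b
      back-< {k} a<k k≤N = subst (N ∸ k <_) N∸a≡b (∸-monoʳ-< a<k k≤N)

      steps : ∀ k → k < N → Adj G (h k) (h (suc k))
      steps k k<N with ≤-<-connex (suc k) a
      ... | inj₁ k<a = subst₂ (Adj G) (sym (h-f (<⇒≤ k<a))) (sym (h-f k<a)) (f-steps k k<a)
      ... | inj₂ a<1+k = subst₂ (Adj G) (sym (h-g a≤k)) (sym (h-g (m≤n⇒m≤1+n a≤k))) back
        where
          a≤k = s≤s⁻¹ a<1+k
          back : Adj G (g (N ∸ k)) (g (N ∸ suc k))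
          back rewrite +-∸-assoc 1 k<N = Adj-sym (g-steps (N ∸ suc k) (back-< a<1+k k<N))

      crossing : ∀ {i k} → i ≤ a → a < k → k ≤ N → h i ≢ h k
      crossing i≤a a<k k≤N hi≡hk =
        disjoint _ _ i≤a (back-< a<k k≤N) (trans (sym (h-f i≤a)) (trans hi≡hk (h-g (<⇒≤ a<k))))

      injective : ∀ k₁ k₂ → k₁ ≤ N → k₂ ≤ N → h k₁ ≡ h k₂ → k₁ ≡ k₂
      injective k₁ k₂ k₁≤N k₂≤N eq with ≤-<-connex k₁ a | ≤-<-connex k₂ a
      ... | inj₁ k₁≤a | inj₁ k₂≤a =
        f-inj k₁ k₂ k₁≤a k₂≤a (trans (sym (h-f k₁≤a)) (trans eq (h-f k₂≤a)))
      ... | inj₁ k₁≤a | inj₂ a<k₂ = ⊥-elim (crossing k₁≤a a<k₂ k₂≤N eq)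
      ... | inj₂ a<k₁ | inj₁ k₂≤a = ⊥-elim (crossing k₂≤a a<k₁ k₁≤N (sym eq))
      ... | inj₂ a<k₁ | inj₂ a<k₂ = ∸-cancelˡ-≡ k₁≤N k₂≤N
        (g-inj _ _ (back-≤ (<⇒≤ a<k₁)) (back-≤ (<⇒≤ a<k₂))
           (trans (sym (h-g (<⇒≤ a<k₁))) (trans eq (h-g (<⇒≤ a<k₂)))))

module _ {n e k : ℕ} (G : Graph n e) (c : Colouring G k) where

  update-≡ : ∀ i x → update G c i x i ≡ just x
  update-≡ i x rewrite dec-true (i ≟ i) refl = refl

  update-≢ : ∀ {i j} x → j ≢ i → update G c i x j ≡ c j
  update-≢ {i} {j} x j≢i rewrite dec-false (j ≟ i) j≢i = refl

  update-≡-coloured : ∀ i x → update G c i x i ≢ nothing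
  update-≡-coloured i x rewrite dec-true (i ≟ i) refl = λ ()

  update-coloured : ∀ i x j → c j ≢ nothing → update G c i x j ≢ nothing
  update-coloured i x j cj≢ with j ≟ i
  ... | yes _ = λ ()
  ... | no  _ = cj≢

  coloured-before-update : ∀ {i x j} → j ≢ i → update G c i x j ≢ nothing → c j ≢ nothing
  coloured-before-update {x = x} j≢i cj≢ = cj≢ ∘ trans (update-≢ x j≢i)

  numColoured-update : ∀ {i} x → c i ≡ nothing → numColoured G (update G c i x) ≡ suc (numColoured G c)
  numColoured-update {i} x ci≡ = countFin-insert i
    (λ j j≢i → cong is-just (update-≢ x j≢i)) (cong is-just ci≡) (cong is-just (update-≡ i x))

-- Rooted trees: depth, parent and the orientation of edges

module Rooted {n e : ℕ} (T : Graph n e) (acyclic : ¬ HasCycle T)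
              (ρ : Fin n) (dist : ∀ v → ∃[ δ ] Dist T v ρ δ) where

  depth : Fin n → ℕ
  depth v = proj₁ (dist v)

  shortest : ∀ v → Walk T v ρ (depth v)
  shortest v = proj₁ (proj₂ (dist v))

  depth-minimal : ∀ {v ℓ} → Walk T v ρ ℓ → depth v ≤ ℓ
  depth-minimal {v} = proj₂ (proj₂ (dist v)) _

  depth-adj : ∀ {u v} → Adj T u v → depth u ≤ suc (depth v)
  depth-adj a = depth-minimal (step a (shortest _))

  depth≡0 : ∀ {v} → depth v ≡ 0 → v ≡ ρ
  depth≡0 {v} eq = ends-at-root (subst (Walk T v ρ) eq (shortest v))
    where ends-at-root : ∀ {u} → Walk T u ρ 0 → u ≡ ρ
          ends-at-root here = refl

  next : ∀ {v ℓ} → Walk T v ρ ℓ → Fin n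
  next {v} here             = v
  next (step {w = w} _ _) = w

  depth-next : ∀ {v ℓ} (w : Walk T v ρ ℓ) → depth v ≡ ℓ → depth (next w) ≡ pred ℓ
  depth-next here                  d≡0 = d≡0
  depth-next (step {w = u} a rest) d≡ =
    ≤-antisym (depth-minimal rest) (s≤s⁻¹ (subst (_≤ suc (depth u)) d≡ (depth-adj a)))

  Adj-next : ∀ {v ℓ} (w : Walk T v ρ ℓ) → 1 ≤ ℓ → Adj T v (next w)
  Adj-next (step a _) _ = a

  -- the root is its own parent
  parent : Fin n → Fin n
  parent v = next (shortest v)

  depth-parent : ∀ v → depth (parent v) ≡ pred (depth v)
  depth-parent v = depth-next (shortest v) refl

  Adj-parent : ∀ {v} → 1 ≤ depth v → Adj T v (parent v)
  Adj-parent {v} = Adj-next (shortest v)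

  ancestor : Fin n → ℕ → Fin n
  ancestor v zero    = v
  ancestor v (suc i) = parent (ancestor v i)

  depth-ancestor : ∀ v i → depth (ancestor v i) ≡ depth v ∸ i
  depth-ancestor v zero    = refl
  depth-ancestor v (suc i) =
    trans (depth-parent _) (trans (cong pred (depth-ancestor v i)) (pred[m∸n]≡m∸[1+n] (depth v) i))

  ancestor-root : ∀ v → ancestor v (depth v) ≡ ρ
  ancestor-root v = depth≡0 (trans (depth-ancestor v (depth v)) (n∸n≡0 (depth v)))

  ancestor-simple : ∀ {v ℓ} → ℓ ≤ depth v → SimplePath T (ancestor v) ℓ
  ancestor-simple {v} ℓ≤d = steps , injective
    where
      steps : ∀ k → k < _ → Adj T (ancestor v k) (ancestor v (suc k))
      steps k k<ℓ =
        Adj-parent (subst (1 ≤_) (sym (depth-ancestor v k)) (m<n⇒0<n∸m (<-≤-trans k<ℓ ℓ≤d)))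
      injective : ∀ i j → i ≤ _ → j ≤ _ → ancestor v i ≡ ancestor v j → i ≡ j
      injective i j i≤ℓ j≤ℓ eq = ∸-cancelˡ-≡ (≤-trans i≤ℓ ℓ≤d) (≤-trans j≤ℓ ℓ≤d)
        (trans (sym (depth-ancestor v i)) (trans (cong depth eq) (depth-ancestor v j)))

  ancestor-offset : ∀ {x y s i j} → depth y ≡ depth x + s → i ≤ depth x → j ≤ depth y →
    ancestor x i ≡ ancestor y j → j ≡ i + s
  ancestor-offset {x} {y} {s} {i} {j} dy i≤ j≤ eq = +-cancelˡ-≡ (depth x ∸ i) j (i + s) (begin
    depth x ∸ i + j      ≡⟨ cong (_+ j) (trans (sym (depth-ancestor x i))
                                                (trans (cong depth eq) (depth-ancestor y j))) ⟩
    depth y ∸ j + j      ≡⟨ m∸n+n≡m j≤ ⟩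
    depth y              ≡⟨ dy ⟩
    depth x + s          ≡⟨ cong (_+ s) (sym (m∸n+n≡m i≤)) ⟩
    depth x ∸ i + i + s  ≡⟨ +-assoc (depth x ∸ i) i s ⟩
    depth x ∸ i + (i + s) ∎)
    where open ≡-Reasoning

  -- The ancestor chains of x and y meet at the root; if they met above x, the first
  -- meeting point and the edge xy would close a cycle.
  adjacent⇒ancestor : ∀ {x y s} → Adj T x y → depth y ≡ depth x + s → x ≡ ancestor y s
  adjacent⇒ancestor {x} {y} {s} x~y dy
    with least-witness (λ a → ancestor x a ≡ ancestor y (a + s)) (λ a → ancestor x a ≟ ancestor y (a + s))
           (depth x) (trans (ancestor-root x) (sym (subst (λ k → ancestor y k ≡ ρ) dy (ancestor-root y))))
  ... | zero  , _   , x≡ , _      = x≡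
  ... | suc a , a<d , meet , before = ⊥-elim (acyclic
    (joinPaths⇒cycle T (ancestor x) (suc a) (ancestor y) (suc a + s) two
       (ancestor-simple a<d) (ancestor-simple a+s≤) meet disjoint (Adj-sym T x~y)))
    where
      a+s≤ : suc a + s ≤ depth y
      a+s≤ = subst (suc a + s ≤_) (sym dy) (+-monoˡ-≤ s a<d)
      two : 2 ≤ suc a + (suc a + s)
      two = s≤s (≤-trans (s≤s z≤n) (m≤n+m (suc (a + s)) a))
      disjoint : ∀ i j → i ≤ suc a → j < suc a + s → ancestor x i ≢ ancestor y j
      disjoint i j i≤ j< eq = before i (+-cancelʳ-≤ s (suc i) (suc a) (subst (_< suc a + s) j≡ j<))
                                (subst (λ k → ancestor x i ≡ ancestor y k) j≡ eq)
        where j≡ = ancestor-offset dy (≤-trans i≤ a<d) (≤-trans (<⇒≤ j<) a+s≤) eq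

  adjacent-depth≢ : ∀ {x y} → Adj T x y → depth x ≢ depth y
  adjacent-depth≢ x~y eq = Adj-irrefl T x~y (adjacent⇒ancestor x~y (trans (sym eq) (sym (+-identityʳ _))))

  adjacent⇒parent : ∀ {x y} → Adj T x y → depth y ≡ suc (depth x) → parent y ≡ x
  adjacent⇒parent x~y eq = sym (adjacent⇒ancestor x~y (trans eq (+-comm 1 _)))

  ChildOf : Fin n → Fin n → Set
  ChildOf x y = 1 ≤ depth x × parent x ≡ y

  adjacent⇒child : ∀ {x y} → Adj T x y → ChildOf x y ⊎ ChildOf y x
  adjacent⇒child {x} {y} x~y with <-cmp (depth x) (depth y)
  ... | tri< lt _ _ =
    inj₂ (<-≤-trans (s≤s z≤n) lt , adjacent⇒parent x~y (≤-antisym (depth-adj (Adj-sym T x~y)) lt))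
  ... | tri≈ _ eq _ = ⊥-elim (adjacent-depth≢ x~y eq)
  ... | tri> _ _ gt =
    inj₁ (<-≤-trans (s≤s z≤n) gt , adjacent⇒parent (Adj-sym T x~y) (≤-antisym (depth-adj x~y) gt))

  deepest-neighbour : ∀ {x c} → (∀ v → depth v ≤ depth x) → Adj T x c → parent x ≡ c
  deepest-neighbour {x} {c} deepest x~c with adjacent⇒child x~c
  ... | inj₁ (_ , px≡c)  = px≡c
  ... | inj₂ (pos , pc≡x) = ⊥-elim (1+n≰n (subst (_≤ depth x) deeper (deepest c)))
    where
      deeper : depth c ≡ suc (depth x)
      deeper = begin
        depth c                 ≡⟨ sym (suc-pred _ {{>-nonZero pos}}) ⟩
        suc (pred (depth c))    ≡⟨ cong suc (sym (depth-parent c)) ⟩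
        suc (depth (parent c))  ≡⟨ cong (suc ∘ depth) pc≡x ⟩
        suc (depth x)           ∎
        where open ≡-Reasoning

  ParentEdge : Fin n → Fin e → Set
  ParentEdge v i = 1 ≤ depth v × SameEnds (ends T i) (v , parent v)

  parentEdge-exists : ∀ {v} → 1 ≤ depth v → ∃[ i ] ParentEdge v i
  parentEdge-exists pos = proj₁ (Adj-parent pos) , pos , proj₂ (Adj-parent pos)

  parentEdge-unique : ∀ {v i j} → ParentEdge v i → ParentEdge v j → i ≡ j
  parentEdge-unique {i = i} {j} (_ , si) (_ , sj) = noMulti T i j (SameEnds-trans si (SameEnds-sym sj))

  parentEdge-child-unique : ∀ {v w i} → ParentEdge v i → ParentEdge w i → v ≡ w
  parentEdge-child-unique {v} {w} (pos-v , sv) (pos-w , sw) with SameEnds-trans (SameEnds-sym sv) sw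
  ... | inj₁ (v≡w , _)      = v≡w
  ... | inj₂ (v≡pw , pv≡w) = ⊥-elim (<-asym (shallower v≡pw pos-w) (shallower (sym pv≡w) pos-v))
    where
      shallower : ∀ {x y} → x ≡ parent y → 1 ≤ depth y → depth x < depth y
      shallower {y = y} x≡py pos = subst (_< depth y) (sym (trans (cong depth x≡py) (depth-parent y)))
                                         (m≤pred[n]⇒suc[m]≤n {{>-nonZero pos}} ≤-refl)

  orientation : ∀ i → Σ (Fin n) λ v → ParentEdge v i
  orientation i with adjacent⇒child (Adj-ends T i)
  ... | inj₁ (pos , eq) = _ , pos , inj₁ (refl , sym eq)
  ... | inj₂ (pos , eq) = _ , pos , inj₂ (sym eq , refl)

  lower : Fin e → Fin n
  lower i = proj₁ (orientation i)

  upper : Fin e → Fin n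
  upper i = parent (lower i)

  parentEdge-lower : ∀ i → ParentEdge (lower i) i
  parentEdge-lower i = proj₂ (orientation i)

  upper-parentEdge : ∀ {v i} → ParentEdge v i → upper i ≡ parent v
  upper-parentEdge pe = cong parent (parentEdge-child-unique (parentEdge-lower _) pe)

  endpoint-lower-upper : ∀ {z i} → Endpoint T z i → z ≡ lower i ⊎ z ≡ upper i
  endpoint-lower-upper {i = i} z∈i with proj₂ (parentEdge-lower i) | z∈i
  ... | inj₁ (a≡l , _) | inj₁ z≡a = inj₁ (trans z≡a a≡l)
  ... | inj₁ (_ , b≡u) | inj₂ z≡b = inj₂ (trans z≡b b≡u)
  ... | inj₂ (a≡u , _) | inj₁ z≡a = inj₂ (trans z≡a a≡u)
  ... | inj₂ (_ , b≡l) | inj₂ z≡b = inj₁ (trans z≡b b≡l)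

  upper-endpoint : ∀ i → Endpoint T (upper i) i
  upper-endpoint i with proj₂ (parentEdge-lower i)
  ... | inj₁ (_ , b≡u) = inj₂ (sym b≡u)
  ... | inj₂ (a≡u , _) = inj₁ (sym a≡u)

  depth-upper : ∀ {v i} → ParentEdge v i → depth (upper i) ≡ pred (depth v)
  depth-upper pe = trans (cong depth (upper-parentEdge pe)) (depth-parent _)

-- Centres

eccentric-leaf : ∀ {n e} (T : Graph n e) {d w v c₁ c₂} → ¬ HasCycle T →
  (∀ x y → ∃[ δ ] (Dist T x y δ × δ ≤ d)) → Dist T w v d → Adj T w c₁ → Adj T w c₂ → c₁ ≡ c₂
eccentric-leaf T {d} {w} {v} acyclic within wv w~c₁ w~c₂ =
  trans (sym (deepest-neighbour deepest w~c₁)) (deepest-neighbour deepest w~c₂)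
  where
    open Rooted T acyclic v (λ x → proj₁ (within x v) , proj₁ (proj₂ (within x v)))
    deepest : ∀ x → depth x ≤ depth w
    deepest x =
      subst (depth x ≤_) (Dist-unique T wv (proj₁ (proj₂ (within w v)))) (proj₂ (proj₂ (within x v)))

diametral-middle : ∀ {n e} (T : Graph n e) {u v r} → Dist T u v (suc (suc r)) →
  ∃[ w ] ∃[ c ] (Adj T w u × Adj T w c × u ≢ c)
diametral-middle T (step u~w (step w~c rest) , shortest) =
  _ , _ , Adj-sym T u~w , w~c , λ { refl → 1+n≰n (≤-trans (n≤1+n _) (shortest _ rest)) }

centre : ∀ {n e} (T : Graph n e) {d r u₀ v₀} → ¬ HasCycle T →
  (∀ x y → ∃[ δ ] (Dist T x y δ × δ ≤ d)) → Dist T u₀ v₀ d → d ≤ suc (suc r) →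
  ∃[ ρ ] Eccentricity≤ T ρ (suc r)
centre T {d} {r} {u₀} acyclic within diametral d≤r+2 with d ≤? suc r
... | yes d≤r+1 = u₀ , λ v → let (δ , v-u₀ , δ≤d) = within v u₀ in δ , v-u₀ , ≤-trans δ≤d d≤r+1
... | no  d≰r+1 =
  middle (diametral-middle T (subst (Dist T u₀ _) (≤-antisym d≤r+2 (≰⇒> d≰r+1)) diametral))
  where
    middle : ∃[ w ] ∃[ c ] (Adj T w u₀ × Adj T w c × u₀ ≢ c) → ∃[ ρ ] Eccentricity≤ T ρ (suc r)
    middle (w , c , w~u₀ , w~c , u₀≢c) = w , near
      where
        near : Eccentricity≤ T w (suc r)
        near v with within v w
        ... | δ , v-w , δ≤d with δ ≤? suc r
        ...   | yes δ≤r+1 = δ , v-w , δ≤r+1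
        ...   | no  δ≰r+1 = ⊥-elim (u₀≢c (eccentric-leaf T acyclic within (Dist-sym T w-v) w~u₀ w~c))
          where w-v = subst (Dist T v w) (≤-antisym δ≤d (≤-trans d≤r+2 (≰⇒> δ≰r+1))) v-w

-- Maker's strategy

module Strategy {n e : ℕ} (T : Graph n e) (acyclic : ¬ HasCycle T) (m : ℕ)
                (ρ : Fin n) (near : Eccentricity≤ T ρ (suc m)) where

  open Rooted T acyclic ρ (λ v → proj₁ (near v) , proj₁ (proj₂ (near v)))

  colours : ℕ
  colours = suc (maxDegree T)

  State : Set
  State = Colouring T colours

  upper-shallow : ∀ i → depth (upper i) ≤ m
  upper-shallow i =
    subst (_≤ m) (sym (depth-parent (lower i))) (pred-mono-≤ (proj₂ (proj₂ (near (lower i)))))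

  ParentColoured : State → Fin e → Set
  ParentColoured c j = ∀ i → ParentEdge (upper j) i → c i ≢ nothing

  ClosedExcept : State → Fin e → Set
  ClosedExcept c h = ∀ j → c j ≢ nothing → j ≢ h → ParentColoured c j

  Closed : State → Set
  Closed c = ∀ j → c j ≢ nothing → ParentColoured c j

  parentColoured-root : ∀ {c j} → depth (upper j) ≡ 0 → ParentColoured c j
  parentColoured-root d≡0 i (pos , _) = ⊥-elim (1+n≰n (subst (1 ≤_) d≡0 pos))

  parentColoured-edge : ∀ {c j i} → ParentEdge (upper j) i → c i ≢ nothing → ParentColoured c j
  parentColoured-edge {c} pe ci≢ i′ pe′ = subst (λ k → c k ≢ nothing) (parentEdge-unique pe pe′) ci≢

  parentColoured-update : ∀ {c j i x} → ParentColoured c j → ParentColoured (update T c i x) j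
  parentColoured-update {c} {i = i} {x} pc i′ pe = update-coloured T c i x i′ (pc i′ pe)

  parentColoured-or-pending : ∀ c h → ParentColoured c h ⊎ ∃[ i ] (ParentEdge (upper h) i × c i ≡ nothing)
  parentColoured-or-pending c h with 1 ≤? depth (upper h)
  ... | no  d≯0 = inj₁ (parentColoured-root (n≤0⇒n≡0 (≮⇒≥ d≯0)))
  ... | yes pos with parentEdge-exists pos
  ...   | i , pe with ≡-dec-Maybe _≟_ (c i) nothing
  ...     | yes ci≡ = inj₂ (i , pe , ci≡)
  ...     | no  ci≢ = inj₁ (parentColoured-edge pe ci≢)

  closedExcept⇒closed : ∀ {c h} → ClosedExcept c h → ParentColoured c h → Closed c
  closedExcept⇒closed {h = h} ce pc j cj≢ with j ≟ h
  ... | yes refl = pc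
  ... | no  j≢h  = ce j cj≢ j≢h

  climb : ∀ {c} k g → depth (upper g) ≤ k → c g ≡ nothing →
    ∃[ g′ ] (c g′ ≡ nothing × ParentColoured c g′)
  climb zero    g d≤0 cg≡ = g , cg≡ , parentColoured-root (n≤0⇒n≡0 d≤0)
  climb {c} (suc k) g d≤k+1 cg≡ with parentColoured-or-pending c g
  ... | inj₁ pc             = g , cg≡ , pc
  ... | inj₂ (i , pe , ci≡) = climb k i (subst (_≤ k) (sym (depth-upper pe)) (pred-mono-≤ d≤k+1)) ci≡

  -- Apart from h, every coloured edge meeting g at its lower end is a child edge of g,
  -- which cannot be coloured while g is not.
  blocking : ∀ {c h g j} → ClosedExcept c h → c g ≡ nothing → j ≢ g → EdgeAdj T g j →
    c j ≢ nothing → j ≡ h ⊎ Endpoint T (upper g) j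
  blocking {c} {h} {g} {j} ce cg≡ j≢g g~j cj≢ with EdgeAdj⇒commonEnd T g~j
  ... | z , z∈g , z∈j with endpoint-lower-upper z∈g
  ...   | inj₂ z≡upper = inj₂ (subst (λ v → Endpoint T v j) z≡upper z∈j)
  ...   | inj₁ z≡lower with endpoint-lower-upper z∈j | j ≟ h
  ...     | inj₁ z≡lower′ | _       = ⊥-elim (j≢g (parentEdge-unique
              (subst (λ v → ParentEdge v j) (trans (sym z≡lower′) z≡lower) (parentEdge-lower j))
              (parentEdge-lower g)))
  ...     | inj₂ _        | yes j≡h = inj₁ j≡h
  ...     | inj₂ z≡upper′ | no  j≢h = ⊥-elim (ce j cj≢ j≢h g
              (subst (λ v → ParentEdge v g) (trans (sym z≡lower) z≡upper′) (parentEdge-lower g)) cg≡)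

  legalColour : ∀ {c h g} → ClosedExcept c h → c g ≡ nothing → ∃[ x ] Legal T c g x
  legalColour {c} {h} {g} ce cg≡ = x , cg≡ , λ j j≢g g~j cj≡x →
    let cj≢ = λ cj≡ → contradiction (trans (sym cj≡x) cj≡) λ () in
    unused j (blocked (blocking ce cg≡ j≢g g~j cj≢) j≢g) cj≡x
    where
      others : Fin e → Bool
      others j = incident T (upper g) j ∧ not (does (j ≟ g))

      Blocked : Fin e → Bool
      Blocked j = does (j ≟ h) ∨ others j

      few : countFin Blocked < colours
      few = s≤s (begin
        countFin Blocked                                  ≤⟨ countFin-∨ _ others ⟩
        countFin (λ j → does (j ≟ h)) + countFin others   ≡⟨ cong (_+ countFin others) (countFin-≟ h) ⟩
        suc (countFin others)                             ≡⟨ degree-∸1 T (upper-endpoint g) ⟩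
        degree T (upper g)                                ≤⟨ degree≤maxDegree T (upper g) ⟩
        maxDegree T                                       ∎)
        where open ≤-Reasoning

      x = proj₁ (unusedColour Blocked c few)
      unused = proj₂ (unusedColour Blocked c few)

      blocked : ∀ {j} → j ≡ h ⊎ Endpoint T (upper g) j → j ≢ g → Blocked j ≡ true
      blocked (inj₁ refl) _ rewrite dec-true (h ≟ h) refl = refl
      blocked {j} (inj₂ u∈j) j≢g rewrite incident-endpoint T u∈j | dec-false (j ≟ g) j≢g = ∨-zeroʳ _

  legalColour-closed : ∀ {c g} → Closed c → c g ≡ nothing → ∃[ x ] Legal T c g x
  legalColour-closed {g = g} closed = legalColour {h = g} λ j cj≢ _ → closed j cj≢

  turn : State → ℕ
  turn c = numColoured T c % suc m

  -- The uncoloured edges above h fit into Maker's remaining moves of the current turn.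
  Pending : State → Set
  Pending c = ∃[ h ] (ClosedExcept c h × depth (upper h) + turn c ≤ m)

  Invariant : State → Set
  Invariant c = Closed c ⊎ Pending c

  Move : State → Set
  Move c = ∃[ i ] ∃[ x ] (Legal T c i x × Invariant (update T c i x))

  extendClosed : ∀ {c g} → Closed c → c g ≡ nothing → Move c
  extendClosed {c} {g} closed cg≡ with climb (depth (upper g)) g ≤-refl cg≡
  ... | g′ , cg′≡ , pc with legalColour-closed closed cg′≡
  ...   | x , legal = g′ , x , legal , inj₁ closed′
    where
      closed′ : Closed (update T c g′ x)
      closed′ j cj≢ with j ≟ g′
      ... | yes refl = parentColoured-update pc
      ... | no  _    = parentColoured-update (closed j cj≢)

  makerMove : ∀ {c g} → MakersTurn T m c → Invariant c → c g ≡ nothing → Move c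
  makerMove _ (inj₁ closed) cg≡ = extendClosed closed cg≡
  makerMove {c} mt (inj₂ (h , ce , fits)) cg≡ with parentColoured-or-pending c h
  ... | inj₁ pc = extendClosed (closedExcept⇒closed ce pc) cg≡
  ... | inj₂ (i , pe , ci≡) = i , x , legal , inj₂ (i , ce′ , subst (_≤ m) (sym shift) fits)
    where
      x = proj₁ (legalColour ce ci≡)
      legal = proj₂ (legalColour ce ci≡)

      ce′ : ClosedExcept (update T c i x) i
      ce′ j cj≢ j≢i with j ≟ h
      ... | yes refl = parentColoured-edge pe (update-≡-coloured T c i x)
      ... | no  j≢h  = parentColoured-update (ce j (coloured-before-update T c j≢i cj≢) j≢h)

      shift : depth (upper i) + turn (update T c i x) ≡ depth (upper h) + turn c
      shift = begin
        depth (upper i) + turn (update T c i x)  ≡⟨ cong₂ _+_ (depth-upper pe) turn+1 ⟩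
        pred (depth (upper h)) + suc (turn c)    ≡⟨ +-suc _ (turn c) ⟩
        suc (pred (depth (upper h))) + turn c    ≡⟨ cong (_+ turn c) (suc-pred _ {{>-nonZero (proj₁ pe)}}) ⟩
        depth (upper h) + turn c                 ∎
        where
          open ≡-Reasoning
          turn+1 = trans (cong (_% suc m) (numColoured-update T c x ci≡)) (%-suc-< _ m mt)

  breakersTurn-closed : ∀ {c} → ¬ MakersTurn T m c → Invariant c → Closed c
  breakersTurn-closed _ (inj₁ closed) = closed
  breakersTurn-closed {c} bt (inj₂ (h , ce , fits)) =
    closedExcept⇒closed ce (parentColoured-root (n≤0⇒n≡0 (+-cancelʳ-≤ m (depth (upper h)) 0 fits′)))
    where fits′ = subst (λ t → depth (upper h) + t ≤ m) (%-≮ (numColoured T c) m bt) fits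

  afterBreaker : ∀ {c i x} → ¬ MakersTurn T m c → Closed c → Legal T c i x → Invariant (update T c i x)
  afterBreaker {c} {i} {x} bt closed (ci≡ , _) = inj₂ (i , ce′ , fits)
    where
      ce′ : ClosedExcept (update T c i x) i
      ce′ j cj≢ j≢i = parentColoured-update (closed j (coloured-before-update T c j≢i cj≢))
      fits : depth (upper i) + turn (update T c i x) ≤ m
      fits = subst (λ t → depth (upper i) + t ≤ m) (sym turn≡0)
                   (subst (_≤ m) (sym (+-identityʳ _)) (upper-shallow i))
        where turn≡0 = trans (cong (_% suc m) (numColoured-update T c x ci≡)) (%-suc-≮ _ m bt)

  spend : ∀ {c : State} {i x} fuel → Legal T c i x →
    e ≤ numColoured T c + suc fuel → e ≤ numColoured T (update T c i x) + fuel
  spend {c} {x = x} fuel (ci≡ , _) enough =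
    subst (e ≤_) (trans (+-suc _ fuel) (cong (_+ fuel) (sym (numColoured-update T c x ci≡)))) enough

  makerWins : ∀ fuel c → e ≤ numColoured T c + fuel → Invariant c → MakerWins T m colours c
  makerWins fuel c enough inv with any? (λ g → ≡-dec-Maybe _≟_ (c g) nothing)
  ... | no complete = done (λ g cg≡ → complete (g , cg≡))
  makerWins zero c enough inv | yes (g , cg≡) =
    ⊥-elim (<⇒≱ (countFin-< _ g (cong is-just cg≡)) (subst (e ≤_) (+-identityʳ _) enough))
  makerWins (suc fuel) c enough inv | yes (g , cg≡) with turn c <? m
  ... | yes mt = let (i , x , legal , inv′) = makerMove mt inv cg≡ in
    maker mt i x legal (makerWins fuel _ (spend fuel legal enough) inv′)
  ... | no  bt = let closed = breakersTurn-closed bt inv in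
    breaker bt (g , legalColour-closed closed cg≡)
      (λ i x legal → makerWins fuel _ (spend fuel legal enough) (afterBreaker bt closed legal))

corollary2p2 : ∀ {n e} (T : Graph n e) (m : ℕ) (d : ℕ) →
    IsTree T → 1 ≤ m → IsDiameter T d → m ≥ d ∸ 2 →
    GameChromaticIndex≤ T m (suc (maxDegree T))
corollary2p2 {e = e} T m d (_ , acyclic) _ (within , _ , _ , diametral) m≥d∸2 =
  suc (maxDegree T) , ≤-refl ,
  makerWins e (empty T) (m≤n+m e _) (inj₁ λ _ coloured → ⊥-elim (coloured refl))
  where
    d≤m+2 : d ≤ suc (suc m)
    d≤m+2 = ≤-trans (m≤n+m∸n d 2) (+-monoʳ-≤ 2 m≥d∸2)
    open Strategy T acyclic m _ (proj₂ (centre T acyclic within diametral d≤m+2))
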